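{- If $n$ is prime, then $t(n)=n-2$.
   Context: A cyclic permutation of order $n$ is a bijective labeling of the vertices of a cycle of length $n$ by the elements of $[n]$, up to rotation of the cycle (reflections are not identified). A swap exchanges the labels of any two (not necessarily adjacent) vertices. $t(n)$ is the maximum, over all cyclic permutations of order $n$, of the minimum number of swaps needed to transform it into the trivial cyclic permutation $(1,2,\ldots,n)$ (labels $1,\ldots,n$ consecutively in order around the cycle). Equivalently, with $c=(1,2,\ldots,n)\in S_n$, $C_n=\langle c\rangle$ and $\operatorname{cyc}(\sigma)$ the number of cycles of $\sigma\in S_n$ (fixed points included), $t(n)=\max_{\pi\in S_n}\min_{\sigma\in\pi C_n}(n-\operatorname{cyc}(\sigma))$. -}

module Defs where

open import Data.Nat using (ℕ; zero; suc; _≤_; _∸_)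
open import Data.Nat.DivMod using (_%_; m%n<n)
open import Data.Nat.Properties using (_≤?_)
open import Data.Fin using (Fin; toℕ; fromℕ<)
open import Data.Fin.Properties using (all?)
open import Data.Fin.Permutation using (Permutation′; _⟨$⟩ʳ_)
open import Data.List using (List; length; filter)
open import Data.List using (allFin) public
open import Relation.Nullary using (Dec)
open import Data.Product using (Σ; _×_)

-- c^k : the k-th power of the long cycle c = (1 2 … n), i ↦ i + k (mod n)
-- (labels 1..n are represented by Fin n = {0..n-1}).
cpow : ∀ {n} → ℕ → Fin n → Fin n
cpow {suc m} k i = fromℕ< (m%n<n (toℕ i + k) (suc m))
  where open Data.Nat using (_+_)

iter : ∀ {n} → (Fin n → Fin n) → ℕ → Fin n → Fin n
iter f zero    i = i
iter f (suc j) i = f (iter f j i)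

IsCycleMin : ∀ {n} → (Fin n → Fin n) → Fin n → Set
IsCycleMin {n} f i = ∀ (j : Fin n) → toℕ i ≤ toℕ (iter f (toℕ j) i)

_·c^_ : ∀ {n} → Permutation′ n → ℕ → Fin n → Fin n
(π ·c^ k) i = π ⟨$⟩ʳ cpow k i

isCycleMin? : ∀ {n} (f : Fin n → Fin n) (i : Fin n) → Dec (IsCycleMin f i)
isCycleMin? {n} f i = all? {P = λ j → toℕ i ≤ toℕ (iter f (toℕ j) i)} (λ j → toℕ i ≤? toℕ (iter f (toℕ j) i))

-- cyc(σ): the number of cycles of σ (fixed points included), counted as
-- the number of elements that are least in their cycle (one per cycle).
cycF : ∀ {n} → (Fin n → Fin n) → ℕ
cycF {n} f = length (filter (isCycleMin? f) (allFin n))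

-- d(π,k) = n − cyc(π c^k): number of swaps needed to sort π c^k
dist : ∀ {n} → Permutation′ n → Fin n → ℕ
dist {n} π k = n ∸ cycF (π ·c^ toℕ k)

-- "t(n) = m", i.e. m = max_{π ∈ S_n} min_{σ ∈ π C_n} (n − cyc σ),
-- with C_n = {c^k | k < n}; unfolded for finite nonempty index sets:
-- some π attains min ≥ m, and every π has min ≤ m.
TEquals : ℕ → ℕ → Set
TEquals n m =
  Σ (Permutation′ n) (λ π → ∀ (k : Fin n) → m ≤ dist π k)
  × (∀ (π : Permutation′ n) → Σ (Fin n) (λ k → dist π k ≤ m))

{-# OPTIONS --safe #-}
-- Swaps needed for a permutation = n − (number of cycles), so the claim is that some coset
-- π C_p has only elements with at most two cycles, while every coset π C_n has an element
-- with at least two. For the latter take k = π⁻¹(0): then π c^k fixes 0. For the former let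
-- π be multiplication by a primitive root g mod p: π c^k is the affine map x ↦ g (x + k),
-- which has a fixed point x₀ (as g ≠ 1) and acts on the other p − 1 points as
-- x − x₀ ↦ g (x − x₀), a single cycle. The primitive root comes from the classical argument:
-- the least exponent E of the units is the order of a unit, obtained as a product of units
-- of prime-power order, and E ≥ p − 1 because x^E − 1 has at most E roots mod p.
module Submission where

open import Defs
open import Data.Fin.Base using (Fin; zero; suc; toℕ; fromℕ<; inject≤; punchOut)
open import Data.Fin.Permutation using (Permutation′; permutation; _⟨$⟩ʳ_; _⟨$⟩ˡ_; inverseˡ; inverseʳ)
import Data.Fin.Permutation as Permutation
open import Data.Fin.Properties
  using (any?; all?; ¬∀⟶∃¬; pigeonhole; injective⇒≤; punchOut-injective;
         toℕ-injective; toℕ<n; toℕ-fromℕ<; inject≤-injective; suc-injective)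
  renaming (_≟_ to _≟ᶠ_)
open import Data.Integer.Base using (ℤ; +_; _+_; _*_; -_; _-_; _^_; 0ℤ; 1ℤ; -1ℤ)
import Data.Integer.Base as ℤ
open import Data.Integer.DivMod using (_/ℕ_; n%ℕd<d; a≡a%ℕn+[a/ℕn]*n)
import Data.Integer.Divisibility.Signed as ℤ
import Data.Integer.Properties as ℤ
open import Data.Integer.Tactic.RingSolver using (solve-∀)
open import Data.List.Base using (List; []; _∷_; length; filter)
open import Data.List.Properties using (filter-accept)
open import Data.List.Relation.Unary.All using (All; _∷_)
open import Data.List.Relation.Unary.All.Properties using (all-filter)
open import Data.List.Relation.Unary.AllPairs using (_∷_)
open import Data.List.Relation.Unary.Unique.Propositional using (Unique)
open import Data.List.Relation.Unary.Unique.Propositional.Properties using (filter⁺; allFin⁺)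
open import Data.Nat.Base using (ℕ; zero; suc; NonZero; _≤_; _<_; _∸_; _!; z≤n; s≤s; 2+)
import Data.Nat.Base as ℕ
open import Data.Nat.Coprimality using (Coprime; coprime-divisor) renaming (sym to coprime-sym)
open import Data.Nat.DivMod using (_%_; _/_; m≡m%n+[m/n]*n; m<n⇒m%n≡m)
open import Data.Nat.Divisibility
  using (_∣_; _∤_; divides; _∣?_; ∣-refl; ∣-trans; ∣1⇒≡1; 0∣⇒≡0; 1∣_; m∣m*n; n∣m*n;
         *-cancelˡ-∣; *-monoˡ-∣; *-monoʳ-∣; n∣m⇒m%n≡0; m≤n⇒m!∣n!)
open import Data.Nat.GCD using (gcd; gcd-GCD; gcd[m,n]∣m; gcd[m,n]∣n; module Bézout)
open import Data.Nat.Induction using (<-wellFounded)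
open import Data.Nat.ListAction using (product)
open import Data.Nat.Primality
  using (Prime; prime⇒irreducible; prime⇒nonZero; prime⇒nonTrivial; euclidsLemma; ¬prime[0]; ¬prime[1])
open import Data.Nat.Primality.Factorisation using (factorise)
import Data.Nat.Properties as ℕ
import Data.Nat.Tactic.RingSolver as ℕ
open import Data.Product using (∃; ∃-syntax; ∃₂; _×_; _,_; proj₁; proj₂)
open import Data.Sum using (_⊎_; inj₁; inj₂; [_,_]′)
open import Function.Base using (_∘_; id)
open import Function.Definitions using (Injective)
open import Induction.WellFounded using (Acc; acc)
open import Relation.Binary using (IsEquivalence; Setoid; Decidable)
import Relation.Binary.Reasoning.Setoid as SetoidReasoning
open import Relation.Binary.PropositionalEquality
  using (_≡_; _≢_; refl; sym; trans; cong; subst)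
open import Relation.Nullary using (¬_; Dec; yes; no; map′; contradiction; ¬?; _→-dec_; _×-dec_)
open import Relation.Unary using (Pred)
import Relation.Unary as U

-- Elementary number theory

∣∧<⇒≡0 : ∀ {n d} → n ∣ d → d < n → d ≡ 0
∣∧<⇒≡0 {n@(suc _)} {d} n∣d d<n = trans (sym (m<n⇒m%n≡m d<n)) (n∣m⇒m%n≡0 d n n∣d)

∤⇒coprime : ∀ {q m} → Prime q → q ∤ m → Coprime m q
∤⇒coprime q-prime q∤m {d} (d∣m , d∣q) with prime⇒irreducible q-prime d∣q
... | inj₁ d≡1  = d≡1
... | inj₂ refl = contradiction d∣m q∤m

coprime-^ʳ : ∀ {m q} e → Coprime m q → Coprime m (q ℕ.^ e)
coprime-^ʳ zero    _       (_ , d∣1)           = ∣1⇒≡1 d∣1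
coprime-^ʳ (suc e) m⊥q {d} (d∣m , d∣q^[1+e]) = coprime-^ʳ e m⊥q (d∣m , coprime-divisor d⊥q d∣q^[1+e])
  where
  d⊥q : Coprime d _
  d⊥q (c∣d , c∣q) = m⊥q (∣-trans c∣d d∣m , c∣q)

coprime⇒*∣ : ∀ {m n k} → Coprime m n → m ∣ k → n ∣ k → m ℕ.* n ∣ k
coprime⇒*∣ {m} {n} m⊥n (divides u refl) n∣u*m =
  subst (m ℕ.* n ∣_) (ℕ.*-comm m u) (*-monoʳ-∣ m (coprime-divisor (coprime-sym m⊥n) n∣m*u))
  where
  n∣m*u : n ∣ m ℕ.* u
  n∣m*u = subst (n ∣_) (ℕ.*-comm u m) n∣u*m

∣prime^suc⇒ : ∀ {q d} → Prime q → ∀ e → d ∣ q ℕ.^ suc e → d ≡ q ℕ.^ suc e ⊎ d ∣ q ℕ.^ e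
∣prime^suc⇒ {q} {d} q-prime e d∣q^[1+e] with q ∣? d
... | no  q∤d              = inj₂ (coprime-divisor (∤⇒coprime q-prime q∤d) d∣q^[1+e])
... | yes (divides u refl) = multiply e (*-cancelˡ-∣ q (subst (_∣ q ℕ.^ suc e) (ℕ.*-comm u q) d∣q^[1+e]))
  where
  instance _ = prime⇒nonZero q-prime
  multiply : ∀ e → u ∣ q ℕ.^ e → u ℕ.* q ≡ q ℕ.^ suc e ⊎ u ℕ.* q ∣ q ℕ.^ e
  multiply zero    u∣1 = inj₁ (trans (cong (ℕ._* q) (∣1⇒≡1 u∣1)) (ℕ.*-comm 1 q))
  multiply (suc e) u∣q^[1+e] with ∣prime^suc⇒ q-prime e u∣q^[1+e]
  ... | inj₁ refl  = inj₁ (ℕ.*-comm (q ℕ.^ suc e) q)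
  ... | inj₂ u∣q^e = inj₂ (subst (u ℕ.* q ∣_) (ℕ.*-comm (q ℕ.^ e) q) (*-monoˡ-∣ q u∣q^e))

primePowerDecomposition : ∀ {q} → Prime q → ∀ N .⦃ _ : NonZero N ⦄ →
                          ∃₂ λ e M → N ≡ q ℕ.^ e ℕ.* M × q ∤ M
primePowerDecomposition {q} q-prime N = go N (<-wellFounded N)
  where
  instance _ = prime⇒nonTrivial q-prime
  go : ∀ N .⦃ _ : NonZero N ⦄ → Acc _<_ N → ∃₂ λ e M → N ≡ q ℕ.^ e ℕ.* M × q ∤ M
  go N (acc rec) with q ∣? N
  ... | no  q∤N = 0 , N , sym (ℕ.+-identityʳ N) , q∤N
  ... | yes (divides u refl) with go u (rec (ℕ.m<m*n u q (ℕ.nonTrivial⇒n>1 q)))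
    where instance _ = ℕ.m*n≢0⇒m≢0 u
  ... | e , M , refl , q∤M = suc e , M , reassoc (q ℕ.^ e) M q , q∤M
    where
    reassoc : ∀ a b c → a ℕ.* b ℕ.* c ≡ c ℕ.* a ℕ.* b
    reassoc = ℕ.solve-∀

∃primeDivisor : ∀ {N} → 1 < N → ∃[ q ] Prime q × q ∣ N
∃primeDivisor {1} (s≤s ())
∃primeDivisor {N@(2+ _)} _ with factorise N
... | record { factors = q ∷ qs ; isFactorisation = N≡q*qs ; factorsPrime = q-prime ∷ _ } =
  q , q-prime , divides (product qs) (trans N≡q*qs (ℕ.*-comm q (product qs)))

m≤n⇒m∣n! : ∀ {m n} → 0 < m → m ≤ n → m ∣ n !
m≤n⇒m∣n! {suc m} _ m≤n = ∣-trans (m∣m*n (m !)) (m≤n⇒m!∣n! m≤n)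

minimalWitness : ∀ {ℓ} {P : Pred ℕ ℓ} → U.Decidable P → ∀ {n} → P n →
                 ∃[ m ] P m × (∀ {k} → k < m → ¬ P k)
minimalWitness {P = P} P? {n} Pn = go n (<-wellFounded n) Pn
  where
  go : ∀ n → Acc _<_ n → P n → ∃[ m ] P m × (∀ {k} → k < m → ¬ P k)
  go n (acc rec) Pn with ℕ.anyUpTo? P? n
  ... | yes (k , k<n , Pk) = go k (rec k<n) Pk
  ... | no  none           = n , Pn , λ k<n Pk → none (_ , k<n , Pk)

-- Permutations of Fin n and their cycles

injective⇒surjective : ∀ {n} {f : Fin n → Fin n} → Injective _≡_ _≡_ f → ∀ y → ∃[ x ] f x ≡ y
injective⇒surjective {suc n} {f} f-inj y with any? (λ x → f x ≟ᶠ y)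
... | yes hit  = hit
... | no  miss = contradiction (injective⇒≤ h-inj) (ℕ.<-irrefl refl)
  where
  y≢f : ∀ x → y ≢ f x
  y≢f x y≡fx = miss (x , sym y≡fx)
  h : Fin (suc n) → Fin n
  h x = punchOut (y≢f x)
  h-inj : Injective _≡_ _≡_ h
  h-inj {x} {x′} = f-inj ∘ punchOut-injective (y≢f x) (y≢f x′)

injective⇒permutation : ∀ {n} (f : Fin n → Fin n) → Injective _≡_ _≡_ f → Permutation′ n
injective⇒permutation f f-inj =
  permutation f (proj₁ ∘ surj) (proj₂ ∘ surj) (λ x → f-inj (proj₂ (surj (f x))))
  where surj = injective⇒surjective f-inj

length≤2 : ∀ {n ℓ} {Q : Pred (Fin n) ℓ} (x₀ : Fin n) →
           (∀ {x y} → Q x → Q y → x ≢ x₀ → y ≢ x₀ → x ≡ y) →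
           ∀ {xs} → Unique xs → All Q xs → length xs ≤ 2
length≤2 x₀ unique {[]}             _ _ = z≤n
length≤2 x₀ unique {_ ∷ []}         _ _ = s≤s z≤n
length≤2 x₀ unique {_ ∷ _ ∷ []}     _ _ = s≤s (s≤s z≤n)
length≤2 x₀ unique {x ∷ y ∷ z ∷ _} ((x≢y ∷ x≢z ∷ _) ∷ (y≢z ∷ _) ∷ _) (Qx ∷ Qy ∷ Qz ∷ _)
  with x ≟ᶠ x₀ | y ≟ᶠ x₀
... | yes refl | _        = contradiction (unique Qy Qz (x≢y ∘ sym) (x≢z ∘ sym)) y≢z
... | no x≢x₀  | yes refl = contradiction (unique Qx Qz x≢x₀ (y≢z ∘ sym)) x≢z
... | no x≢x₀  | no y≢x₀  = contradiction (unique Qx Qy x≢x₀ y≢x₀) x≢y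

cycF≤2 : ∀ {n} (f : Fin n → Fin n) (x₀ : Fin n) →
         (∀ {x y} → x ≢ x₀ → y ≢ x₀ → ∃[ j ] iter f (toℕ j) x ≡ y) → cycF f ≤ 2
cycF≤2 {n} f x₀ connected =
  length≤2 x₀ minima-equal (filter⁺ (isCycleMin? f) (allFin⁺ n)) (all-filter (isCycleMin? f) (allFin n))
  where
  below : ∀ {x y} → IsCycleMin f x → x ≢ x₀ → y ≢ x₀ → toℕ x ≤ toℕ y
  below {x} x-min x≢x₀ y≢x₀ with j , x↝y ← connected x≢x₀ y≢x₀ =
    subst (λ z → toℕ x ≤ toℕ z) x↝y (x-min j)
  minima-equal : ∀ {x y} → IsCycleMin f x → IsCycleMin f y → x ≢ x₀ → y ≢ x₀ → x ≡ y
  minima-equal x-min y-min x≢x₀ y≢x₀ =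
    toℕ-injective (ℕ.≤-antisym (below x-min x≢x₀ y≢x₀) (below y-min y≢x₀ x≢x₀))

cycF≥2 : ∀ {n} (f : Fin (2+ n) → Fin (2+ n)) → Injective _≡_ _≡_ f → f zero ≡ zero → 2 ≤ cycF f
cycF≥2 f f-inj f0≡0 = subst (λ xs → 2 ≤ length xs) (sym filter≡) (s≤s (s≤s z≤n))
  where
  orbit-avoids-zero : ∀ j → iter f j (suc zero) ≢ zero
  orbit-avoids-zero zero    ()
  orbit-avoids-zero (suc j) fx≡0 = orbit-avoids-zero j (f-inj (trans fx≡0 (sym f0≡0)))
  one-min : IsCycleMin f (suc zero)
  one-min j with iter f (toℕ j) (suc zero) | orbit-avoids-zero (toℕ j)
  ... | zero  | ≢0 = contradiction refl ≢0
  ... | suc _ | _  = s≤s z≤n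
  filter≡ : filter (isCycleMin? f) (allFin _) ≡ zero ∷ suc zero ∷ _
  filter≡ = trans (filter-accept (isCycleMin? f) (λ _ → z≤n))
                  (cong (zero ∷_) (filter-accept (isCycleMin? f) one-min))

-- Integer powers and polynomials

^-distribʳ-* : ∀ a b k → (a * b) ^ k ≡ a ^ k * b ^ k
^-distribʳ-* a b zero    = refl
^-distribʳ-* a b (suc k) = trans (cong ((a * b) *_) (^-distribʳ-* a b k)) (interchange a b (a ^ k) (b ^ k))
  where
  interchange : ∀ a b c d → a * b * (c * d) ≡ a * c * (b * d)
  interchange = solve-∀

⟦_⟧ : List ℤ → ℤ → ℤ
⟦ []     ⟧ x = 0ℤ
⟦ c ∷ cs ⟧ x = c + x * ⟦ cs ⟧ x

-- The quotient of c ∷ cs by x - a, which does not depend on the constant term c.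
divideBy : ℤ → List ℤ → List ℤ
divideBy a []       = []
divideBy a (c ∷ cs) = ⟦ c ∷ cs ⟧ a ∷ divideBy a cs

length-divideBy : ∀ a cs → length (divideBy a cs) ≡ length cs
length-divideBy a []       = refl
length-divideBy a (c ∷ cs) = cong suc (length-divideBy a cs)

⟦⟧-divideBy : ∀ a c cs x → ⟦ c ∷ cs ⟧ x ≡ (x - a) * ⟦ divideBy a cs ⟧ x + ⟦ c ∷ cs ⟧ a
⟦⟧-divideBy a c []        x = regroup a c x
  where
  regroup : ∀ a c x → c + x * 0ℤ ≡ (x - a) * 0ℤ + (c + a * 0ℤ)
  regroup = solve-∀
⟦⟧-divideBy a c (c′ ∷ cs) x =
  trans (cong (λ v → c + x * v) (⟦⟧-divideBy a c′ cs x))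
        (regroup a c x (⟦ divideBy a cs ⟧ x) (⟦ c′ ∷ cs ⟧ a))
  where
  regroup : ∀ a c x q r → c + x * ((x - a) * q + r) ≡ (x - a) * (r + x * q) + (c + a * r)
  regroup = solve-∀

monomial : ℕ → List ℤ
monomial zero    = 1ℤ ∷ []
monomial (suc k) = 0ℤ ∷ monomial k

length-monomial : ∀ k → length (monomial k) ≡ suc k
length-monomial zero    = refl
length-monomial (suc k) = cong suc (length-monomial k)

⟦monomial⟧ : ∀ k x → ⟦ monomial k ⟧ x ≡ x ^ k
⟦monomial⟧ zero    x = cong (_+_ 1ℤ) (ℤ.*-zeroʳ x)
⟦monomial⟧ (suc k) x = trans (ℤ.+-identityˡ _) (cong (x *_) (⟦monomial⟧ k x))

toℕ-cpow : ∀ {n} .⦃ _ : NonZero n ⦄ k (i : Fin n) → toℕ (cpow k i) ≡ (toℕ i ℕ.+ k) % n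
toℕ-cpow {suc _} k i = toℕ-fromℕ< _

module Congruence (n : ℕ) ⦃ _ : NonZero n ⦄ where

  infix 4 _≈_ _≉_ _≈?_

  -- Wrapped in a record so that a and b can be inferred from a proof of a ≈ b.
  record _≈_ (a b : ℤ) : Set where
    constructor mk≈
    field n∣a-b : + n ℤ.∣ a - b

  _≉_ : ℤ → ℤ → Set
  a ≉ b = ¬ a ≈ b

  private
    ≈-by : ∀ {x a b} → x ≡ a - b → + n ℤ.∣ x → a ≈ b
    ≈-by x≡a-b n∣x = mk≈ (subst (+ n ℤ.∣_) x≡a-b n∣x)

  ≈-refl : ∀ {a} → a ≈ a
  ≈-refl {a} = mk≈ (ℤ.divides 0ℤ (ℤ.+-inverseʳ a))

  ≈-sym : ∀ {a b} → a ≈ b → b ≈ a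
  ≈-sym {a} {b} (mk≈ n∣a-b) = ≈-by (negate a b) (ℤ.∣m⇒∣-m n∣a-b)
    where
    negate : ∀ a b → - (a - b) ≡ b - a
    negate = solve-∀

  ≈-trans : ∀ {a b c} → a ≈ b → b ≈ c → a ≈ c
  ≈-trans {a} {b} {c} (mk≈ n∣a-b) (mk≈ n∣b-c) = ≈-by (telescope a b c) (ℤ.∣m∣n⇒∣m+n n∣a-b n∣b-c)
    where
    telescope : ∀ a b c → (a - b) + (b - c) ≡ a - c
    telescope = solve-∀

  ≈-isEquivalence : IsEquivalence _≈_
  ≈-isEquivalence = record { refl = ≈-refl ; sym = ≈-sym ; trans = ≈-trans }

  ≈-setoid : Setoid _ _
  ≈-setoid = record { isEquivalence = ≈-isEquivalence }

  module ≈-Reasoning = SetoidReasoning ≈-setoid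

  ≡⇒≈ : ∀ {a b} → a ≡ b → a ≈ b
  ≡⇒≈ refl = ≈-refl

  _≈?_ : Decidable _≈_
  a ≈? b = map′ mk≈ _≈_.n∣a-b (+ n ℤ.∣? a - b)

  +-cong : ∀ {a b c d} → a ≈ b → c ≈ d → a + c ≈ b + d
  +-cong {a} {b} {c} {d} (mk≈ n∣a-b) (mk≈ n∣c-d) = ≈-by (regroup a b c d) (ℤ.∣m∣n⇒∣m+n n∣a-b n∣c-d)
    where
    regroup : ∀ a b c d → (a - b) + (c - d) ≡ (a + c) - (b + d)
    regroup = solve-∀

  -‿cong : ∀ {a b} → a ≈ b → - a ≈ - b
  -‿cong {a} {b} (mk≈ n∣a-b) = ≈-by (negate a b) (ℤ.∣m⇒∣-m n∣a-b)
    where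
    negate : ∀ a b → - (a - b) ≡ - a - - b
    negate = solve-∀

  *-cong : ∀ {a b c d} → a ≈ b → c ≈ d → a * c ≈ b * d
  *-cong {a} {b} {c} {d} (mk≈ n∣a-b) (mk≈ n∣c-d) =
    ≈-by (regroup a b c d) (ℤ.∣m∣n⇒∣m+n (ℤ.∣n⇒∣m*n a n∣c-d) (ℤ.∣m⇒∣m*n d n∣a-b))
    where
    regroup : ∀ a b c d → a * (c - d) + (a - b) * d ≡ a * c - b * d
    regroup = solve-∀

  ^-cong : ∀ {a b} k → a ≈ b → a ^ k ≈ b ^ k
  ^-cong zero    a≈b = ≈-refl
  ^-cong (suc k) a≈b = *-cong a≈b (^-cong k a≈b)

  +-cancelʳ : ∀ {a b} c → a + c ≈ b + c → a ≈ b
  +-cancelʳ {a} {b} c (mk≈ n∣a+c-b+c) = ≈-by (cancel a b c) n∣a+c-b+c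
    where
    cancel : ∀ a b c → (a + c) - (b + c) ≡ a - b
    cancel = solve-∀

  -≈0⇒≈ : ∀ {a b} → a - b ≈ 0ℤ → a ≈ b
  -≈0⇒≈ {a} {b} (mk≈ n∣a-b-0) = ≈-by (ℤ.+-identityʳ (a - b)) n∣a-b-0

  +-multiple≈ : ∀ a q → a + q * + n ≈ a
  +-multiple≈ a q = mk≈ (ℤ.divides q (cancel a q (+ n)))
    where
    cancel : ∀ a q m → a + q * m - a ≡ q * m
    cancel = solve-∀

  private
    ≈-canonical-≤ : ∀ {a b} → a ≤ b → b < n → + a ≈ + b → a ≡ b
    ≈-canonical-≤ {a} {b} a≤b b<n (mk≈ n∣a-b) =
      ℕ.≤-antisym a≤b (ℕ.m∸n≡0⇒m≤n (∣∧<⇒≡0 n∣b∸a (ℕ.≤-<-trans (ℕ.m∸n≤m b a) b<n)))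
      where
      n∣b∸a : n ∣ b ∸ a
      n∣b∸a = subst (n ∣_) (trans (cong ℤ.∣_∣ (ℤ.[+m]-[+n]≡m⊖n a b)) (ℤ.∣⊖∣-≤ a≤b)) (ℤ.∣⇒∣ᵤ n∣a-b)

  ≈-canonical : ∀ {a b} → a < n → b < n → + a ≈ + b → a ≡ b
  ≈-canonical {a} {b} a<n b<n a≈b with ℕ.≤-total a b
  ... | inj₁ a≤b = ≈-canonical-≤ a≤b b<n a≈b
  ... | inj₂ b≤a = sym (≈-canonical-≤ b≤a a<n (≈-sym a≈b))

  [_] : Fin n → ℤ
  [ i ] = + toℕ i

  [_]-injective : ∀ {i j} → [ i ] ≈ [ j ] → i ≡ j
  [_]-injective {i} {j} i≈j = toℕ-injective (≈-canonical (toℕ<n i) (toℕ<n j) i≈j)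

  reduce : ℤ → Fin n
  reduce a = fromℕ< (n%ℕd<d a n)

  [reduce] : ∀ a → [ reduce a ] ≈ a
  [reduce] a = begin
    [ reduce a ]                          ≈⟨ +-multiple≈ _ (a /ℕ n) ⟨
    [ reduce a ] + (a /ℕ n) * + n         ≡⟨ cong (λ r → + r + (a /ℕ n) * + n) (toℕ-fromℕ< (n%ℕd<d a n)) ⟩
    + (a ℤ.%ℕ n) + (a /ℕ n) * + n         ≡⟨ a≡a%ℕn+[a/ℕn]*n a n ⟨
    a                                     ∎
    where open ≈-Reasoning

  reduce-injective : ∀ {a b} → reduce a ≡ reduce b → a ≈ b
  reduce-injective {a} {b} eq = begin
    a              ≈⟨ [reduce] a ⟨
    [ reduce a ]   ≡⟨ cong [_] eq ⟩
    [ reduce b ]   ≈⟨ [reduce] b ⟩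
    b              ∎
    where open ≈-Reasoning

  [cpow] : ∀ k i → [ cpow k i ] ≈ [ i ] + + k
  [cpow] k i = begin
    [ cpow k i ]                                      ≡⟨ cong +_ (toℕ-cpow k i) ⟩
    + ((toℕ i ℕ.+ k) % n)                             ≈⟨ +-multiple≈ _ (+ ((toℕ i ℕ.+ k) / n)) ⟨
    + ((toℕ i ℕ.+ k) % n) + + ((toℕ i ℕ.+ k) / n) * + n ≡⟨ sym (ℕ→ℤ-divMod (toℕ i ℕ.+ k)) ⟩
    + (toℕ i ℕ.+ k)                                   ≡⟨ ℤ.pos-+ (toℕ i) k ⟩
    [ i ] + + k                                       ∎
    where
    open ≈-Reasoning
    ℕ→ℤ-divMod : ∀ m → + m ≡ + (m % n) + + (m / n) * + n
    ℕ→ℤ-divMod m = trans (cong +_ (m≡m%n+[m/n]*n m n))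
                    (trans (ℤ.pos-+ (m % n) _) (cong (_+_ (+ (m % n))) (ℤ.pos-* (m / n) n)))

  cpow-injective : ∀ k → Injective _≡_ _≡_ (cpow {n} k)
  cpow-injective k {i} {j} eq = [_]-injective (+-cancelʳ (+ k) (begin
    [ i ] + + k    ≈⟨ [cpow] k i ⟨
    [ cpow k i ]   ≡⟨ cong [_] eq ⟩
    [ cpow k j ]   ≈⟨ [cpow] k j ⟩
    [ j ] + + k    ∎))
    where open ≈-Reasoning

module PrimeModulus {p : ℕ} (p-prime : Prime p) where

  private instance
    p≢0 : NonZero p
    p≢0 = prime⇒nonZero p-prime

  open Congruence p public

  private
    ≈0⇒∣ : ∀ {a} → a ≈ 0ℤ → p ∣ ℤ.∣ a ∣
    ≈0⇒∣ {a} (mk≈ p∣a-0) = subst (λ x → p ∣ ℤ.∣ x ∣) (ℤ.+-identityʳ a) (ℤ.∣⇒∣ᵤ p∣a-0)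

    ∣⇒≈0 : ∀ {a} → p ∣ ℤ.∣ a ∣ → a ≈ 0ℤ
    ∣⇒≈0 {a} p∣a = mk≈ (subst (+ p ℤ.∣_) (sym (ℤ.+-identityʳ a)) (ℤ.∣ᵤ⇒∣ p∣a))

  1≉0 : 1ℤ ≉ 0ℤ
  1≉0 1≈0 = ℕ.<-irrefl (sym (∣1⇒≡1 (≈0⇒∣ 1≈0))) (ℕ.nonTrivial⇒n>1 p ⦃ prime⇒nonTrivial p-prime ⦄)

  *-≈0 : ∀ {a b} → a * b ≈ 0ℤ → a ≈ 0ℤ ⊎ b ≈ 0ℤ
  *-≈0 {a} {b} ab≈0 with euclidsLemma ℤ.∣ a ∣ ℤ.∣ b ∣ p-prime (subst (p ∣_) (ℤ.abs-* a b) (≈0⇒∣ ab≈0))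
  ... | inj₁ p∣a = inj₁ (∣⇒≈0 p∣a)
  ... | inj₂ p∣b = inj₂ (∣⇒≈0 p∣b)

  *-≉0 : ∀ {a b} → a ≉ 0ℤ → b ≉ 0ℤ → a * b ≉ 0ℤ
  *-≉0 a≉0 b≉0 = [ a≉0 , b≉0 ]′ ∘ *-≈0

  ^-≉0 : ∀ {a} k → a ≉ 0ℤ → a ^ k ≉ 0ℤ
  ^-≉0 zero    a≉0 = 1≉0
  ^-≉0 (suc k) a≉0 = *-≉0 a≉0 (^-≉0 k a≉0)

  *-cancelˡ : ∀ {a b c} → a ≉ 0ℤ → a * b ≈ a * c → b ≈ c
  *-cancelˡ {a} {b} {c} a≉0 (mk≈ p∣ab-ac) with *-≈0 (mk≈ (subst (+ p ℤ.∣_) (factor a b c) p∣ab-ac))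
    where
    factor : ∀ a b c → a * b - a * c ≡ a * (b - c) - 0ℤ
    factor = solve-∀
  ... | inj₁ a≈0   = contradiction a≈0 a≉0
  ... | inj₂ b-c≈0 = -≈0⇒≈ b-c≈0

  *-cancelʳ : ∀ {a b c} → a ≉ 0ℤ → b * a ≈ c * a → b ≈ c
  *-cancelʳ {a} {b} {c} a≉0 ba≈ca = *-cancelˡ a≉0 (begin
    a * b ≡⟨ ℤ.*-comm a b ⟩
    b * a ≈⟨ ba≈ca ⟩
    c * a ≡⟨ ℤ.*-comm c a ⟩
    a * c ∎)
    where open ≈-Reasoning

  ^-cancel : ∀ {a i j} → a ≉ 0ℤ → i ≤ j → a ^ i ≈ a ^ j → a ^ (j ∸ i) ≈ 1ℤ
  ^-cancel {a} {i} {j} a≉0 i≤j a^i≈a^j = ≈-sym (*-cancelˡ (^-≉0 i a≉0) (begin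
    a ^ i * 1ℤ           ≡⟨ ℤ.*-identityʳ (a ^ i) ⟩
    a ^ i                ≈⟨ a^i≈a^j ⟩
    a ^ j                ≡⟨ cong (a ^_) (ℕ.m+[n∸m]≡n i≤j) ⟨
    a ^ (i ℕ.+ (j ∸ i))  ≡⟨ ℤ.^-distribˡ-+-* a i (j ∸ i) ⟩
    a ^ i * a ^ (j ∸ i)  ∎))
    where open ≈-Reasoning

  ^≈1⇒≉0 : ∀ {a} k → a ^ suc k ≈ 1ℤ → a ≉ 0ℤ
  ^≈1⇒≉0 {a} k a^[1+k]≈1 a≈0 = 1≉0 (begin
    1ℤ           ≈⟨ a^[1+k]≈1 ⟨
    a * a ^ k    ≈⟨ *-cong a≈0 ≈-refl ⟩
    0ℤ * a ^ k   ≡⟨ ℤ.*-zeroˡ (a ^ k) ⟩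
    0ℤ           ∎)
    where open ≈-Reasoning

  *≈1⇒≈1ˡ : ∀ {a b} → a * b ≈ 1ℤ → b ≈ 1ℤ → a ≈ 1ℤ
  *≈1⇒≈1ˡ {a} {b} ab≈1 b≈1 = begin
    a       ≡⟨ ℤ.*-identityʳ a ⟨
    a * 1ℤ  ≈⟨ *-cong (≈-refl {a}) b≈1 ⟨
    a * b   ≈⟨ ab≈1 ⟩
    1ℤ      ∎
    where open ≈-Reasoning

  *≈1⇒≈1ʳ : ∀ {a b} → a * b ≈ 1ℤ → a ≈ 1ℤ → b ≈ 1ℤ
  *≈1⇒≈1ʳ {a} {b} ab≈1 = *≈1⇒≈1ˡ (≈-trans (≡⇒≈ (ℤ.*-comm b a)) ab≈1)

  ^≈1-∣ : ∀ {a d k} → a ^ d ≈ 1ℤ → d ∣ k → a ^ k ≈ 1ℤ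
  ^≈1-∣ {a} {d} a^d≈1 (divides q refl) = begin
    a ^ (q ℕ.* d)   ≡⟨ cong (a ^_) (ℕ.*-comm q d) ⟩
    a ^ (d ℕ.* q)   ≡⟨ ℤ.^-*-assoc a d q ⟨
    (a ^ d) ^ q     ≈⟨ ^-cong q a^d≈1 ⟩
    1ℤ ^ q          ≡⟨ ℤ.^-zeroˡ q ⟩
    1ℤ              ∎
    where open ≈-Reasoning

  ^≈1-bézout : ∀ {a d m n} → a ^ m ≈ 1ℤ → a ^ n ≈ 1ℤ → Bézout.Identity d m n → a ^ d ≈ 1ℤ
  ^≈1-bézout {a} {d} {m} {n} a^m≈1 a^n≈1 (Bézout.+- x y d+yn≡xm) =
    *≈1⇒≈1ˡ a^d*a^yn≈1 (^≈1-∣ a^n≈1 (n∣m*n y))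
    where
    a^d*a^yn≈1 : a ^ d * a ^ (y ℕ.* n) ≈ 1ℤ
    a^d*a^yn≈1 = subst (_≈ 1ℤ) (trans (cong (a ^_) (sym d+yn≡xm)) (ℤ.^-distribˡ-+-* a d _))
                       (^≈1-∣ a^m≈1 (n∣m*n x))
  ^≈1-bézout a^m≈1 a^n≈1 (Bézout.-+ x y d+xm≡yn) = ^≈1-bézout a^n≈1 a^m≈1 (Bézout.+- y x d+xm≡yn)

  ^≈1-gcd : ∀ {a m n} → a ^ m ≈ 1ℤ → a ^ n ≈ 1ℤ → a ^ gcd m n ≈ 1ℤ
  ^≈1-gcd {m = m} {n} a^m≈1 a^n≈1 = ^≈1-bézout a^m≈1 a^n≈1 (Bézout.identity (gcd-GCD m n))

  HasOrder : ℤ → ℕ → Set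
  HasOrder a N = a ^ N ≈ 1ℤ × (∀ k → a ^ k ≈ 1ℤ → N ∣ k)

  hasOrder-primePower : ∀ {q y} e → Prime q → y ^ (q ℕ.^ suc e) ≈ 1ℤ → y ^ (q ℕ.^ e) ≉ 1ℤ →
                        HasOrder y (q ℕ.^ suc e)
  hasOrder-primePower {q} {y} e q-prime y^Q≈1 y^q^e≉1 = y^Q≈1 , Q∣
    where
    Q∣ : ∀ k → y ^ k ≈ 1ℤ → q ℕ.^ suc e ∣ k
    Q∣ k y^k≈1 with ∣prime^suc⇒ q-prime e (gcd[m,n]∣n k (q ℕ.^ suc e))
    ... | inj₁ gcd≡Q   = subst (_∣ k) gcd≡Q (gcd[m,n]∣m k _)
    ... | inj₂ gcd∣q^e = contradiction (^≈1-∣ (^≈1-gcd {y} {k} y^k≈1 y^Q≈1) gcd∣q^e) y^q^e≉1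

  hasOrder-* : ∀ {a b M Q} → HasOrder a M → HasOrder b Q → Coprime M Q → HasOrder (a * b) (M ℕ.* Q)
  hasOrder-* {a} {b} {M} {Q} (a^M≈1 , M∣) (b^Q≈1 , Q∣) M⊥Q = [ab]^MQ≈1 , MQ∣
    where
    [ab]^MQ≈1 : (a * b) ^ (M ℕ.* Q) ≈ 1ℤ
    [ab]^MQ≈1 = begin
      (a * b) ^ (M ℕ.* Q)              ≡⟨ ^-distribʳ-* a b (M ℕ.* Q) ⟩
      a ^ (M ℕ.* Q) * b ^ (M ℕ.* Q)    ≈⟨ *-cong (^≈1-∣ {a} {M} a^M≈1 (m∣m*n Q))
                                                 (^≈1-∣ {b} {Q} b^Q≈1 (n∣m*n M)) ⟩
      1ℤ                               ∎
      where open ≈-Reasoning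
    MQ∣ : ∀ k → (a * b) ^ k ≈ 1ℤ → M ℕ.* Q ∣ k
    MQ∣ k [ab]^k≈1 = coprime⇒*∣ M⊥Q (coprime-divisor M⊥Q (M∣ (Q ℕ.* k) a^Qk≈1))
                                    (coprime-divisor (coprime-sym M⊥Q) (Q∣ (M ℕ.* k) b^Mk≈1))
      where
      [ab]^-≈1 : ∀ l → a ^ (l ℕ.* k) * b ^ (l ℕ.* k) ≈ 1ℤ
      [ab]^-≈1 l = subst (_≈ 1ℤ) (^-distribʳ-* a b (l ℕ.* k)) (^≈1-∣ {a * b} {k} [ab]^k≈1 (n∣m*n l))
      a^Qk≈1 = *≈1⇒≈1ˡ ([ab]^-≈1 Q) (^≈1-∣ {b} {Q} b^Q≈1 (m∣m*n k))
      b^Mk≈1 = *≈1⇒≈1ʳ ([ab]^-≈1 M) (^≈1-∣ {a} {M} a^M≈1 (m∣m*n k))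

  hasOrder-injective : ∀ {g N i j} → HasOrder g N → i < N → j < N → g ^ i ≈ g ^ j → i ≡ j
  hasOrder-injective {g} {suc N} (g^N≈1 , N∣) = injective
    where
    below : ∀ {i j} → i ≤ j → j < suc N → g ^ i ≈ g ^ j → j ≤ i
    below {i} {j} i≤j j<N g^i≈g^j =
      ℕ.m∸n≡0⇒m≤n (∣∧<⇒≡0 (N∣ _ (^-cancel (^≈1⇒≉0 N g^N≈1) i≤j g^i≈g^j)) (ℕ.≤-<-trans (ℕ.m∸n≤m j i) j<N))
    injective : ∀ {i j} → i < suc N → j < suc N → g ^ i ≈ g ^ j → i ≡ j
    injective {i} {j} i<N j<N g^i≈g^j with ℕ.≤-total i j
    ... | inj₁ i≤j = ℕ.≤-antisym i≤j (below i≤j j<N g^i≈g^j)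
    ... | inj₂ j≤i = sym (ℕ.≤-antisym j≤i (below j≤i i<N (≈-sym g^i≈g^j)))

  ⟦⟧-vanishes : ∀ {L} cs → length cs ≤ L → (r : Fin L → ℤ) → (∀ {i j} → r i ≈ r j → i ≡ j) →
             (∀ i → ⟦ cs ⟧ (r i) ≈ 0ℤ) → ∀ x → ⟦ cs ⟧ x ≈ 0ℤ
  ⟦⟧-vanishes []       _           r r-inj roots x = ≈-refl
  ⟦⟧-vanishes (c ∷ cs) (s≤s len≤L) r r-inj roots x = begin
    ⟦ c ∷ cs ⟧ x                        ≡⟨ ⟦⟧-divideBy a c cs x ⟩
    (x - a) * ⟦ q ⟧ x + ⟦ c ∷ cs ⟧ a    ≈⟨ +-cong (*-cong (≈-refl {x - a}) (q-vanishes x)) (roots zero) ⟩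
    (x - a) * 0ℤ + 0ℤ                   ≡⟨ cong (_+ 0ℤ) (ℤ.*-zeroʳ (x - a)) ⟩
    0ℤ                                  ∎
    where
    open ≈-Reasoning
    a = r zero
    q = divideBy a cs
    q-roots : ∀ i → ⟦ q ⟧ (r (suc i)) ≈ 0ℤ
    q-roots i with *-≈0 (+-cancelʳ (⟦ c ∷ cs ⟧ a) (begin
      (r (suc i) - a) * ⟦ q ⟧ (r (suc i)) + ⟦ c ∷ cs ⟧ a   ≡⟨ ⟦⟧-divideBy a c cs (r (suc i)) ⟨
      ⟦ c ∷ cs ⟧ (r (suc i))                               ≈⟨ roots (suc i) ⟩
      0ℤ                                                   ≈⟨ roots zero ⟨
      ⟦ c ∷ cs ⟧ a                                         ≡⟨ ℤ.+-identityˡ _ ⟨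
      0ℤ + ⟦ c ∷ cs ⟧ a                                    ∎))
    ... | inj₁ rᵢ-a≈0  = contradiction (r-inj (-≈0⇒≈ rᵢ-a≈0)) λ ()
    ... | inj₂ q[rᵢ]≈0 = q[rᵢ]≈0
    q-vanishes : ∀ x → ⟦ q ⟧ x ≈ 0ℤ
    q-vanishes = ⟦⟧-vanishes q (subst (_≤ _) (sym (length-divideBy a cs)) len≤L) (r ∘ suc)
                          (suc-injective ∘ r-inj) q-roots

  x^E≈1-roots≤E : ∀ {L E} .⦃ _ : NonZero E ⦄ (r : Fin L → ℤ) → (∀ {i j} → r i ≈ r j → i ≡ j) →
                (∀ i → r i ^ E ≈ 1ℤ) → L ≤ E
  x^E≈1-roots≤E {L} {suc E} r r-inj roots = ℕ.≮⇒≥ λ E<L → 1≉0 (-‿cong (x^E-1-vanishes E<L 0ℤ))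
    where
    x^E-1 : List ℤ
    x^E-1 = -1ℤ ∷ monomial E
    ⟦x^E-1⟧ : ∀ x → ⟦ x^E-1 ⟧ x ≡ -1ℤ + x ^ suc E
    ⟦x^E-1⟧ x = cong (λ v → -1ℤ + x * v) (⟦monomial⟧ E x)
    x^E-1-vanishes : suc E < L → ∀ x → ⟦ x^E-1 ⟧ x ≈ 0ℤ
    x^E-1-vanishes E<L = ⟦⟧-vanishes x^E-1 (ℕ.≤-reflexive (cong suc (length-monomial E))) r′
      (λ {i} {j} → inject≤-injective _ _ i j ∘ r-inj)
      (λ i → ≈-trans (≡⇒≈ (⟦x^E-1⟧ (r′ i))) (+-cong (≈-refl { -1ℤ}) (roots _)))
      where
      r′ : Fin (suc (suc E)) → ℤ
      r′ i = r (inject≤ i E<L)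

  Exponent : ℕ → Set
  Exponent e = ∀ {a} → a ≉ 0ℤ → a ^ e ≈ 1ℤ

  private
    exponentAt? : ∀ e (i : Fin p) → Dec ([ i ] ≉ 0ℤ → [ i ] ^ e ≈ 1ℤ)
    exponentAt? e i = ¬? ([ i ] ≈? 0ℤ) →-dec ([ i ] ^ e ≈? 1ℤ)

  exponent⊎counterexample : ∀ e → Exponent e ⊎ ∃[ b ] b ≉ 0ℤ × b ^ e ≉ 1ℤ
  exponent⊎counterexample e with all? (exponentAt? e)
  ... | yes holds = inj₁ λ {a} a≉0 → begin
    a ^ e             ≈⟨ ^-cong e ([reduce] a) ⟨
    [ reduce a ] ^ e  ≈⟨ holds (reduce a) (a≉0 ∘ ≈-trans (≈-sym ([reduce] a))) ⟩
    1ℤ                ∎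
    where open ≈-Reasoning
  ... | no ¬holds with i , fails ← ¬∀⟶∃¬ p _ (exponentAt? e) ¬holds =
    inj₂ ([ i ] , (λ i≈0 → fails λ i≉0 → contradiction i≈0 i≉0) , (λ i^e≈1 → fails λ _ → i^e≈1))

  exponent? : U.Decidable Exponent
  exponent? e = [ yes , (λ { (b , b≉0 , b^e≉1) → no λ exponent → b^e≉1 (exponent b≉0) }) ]′
                (exponent⊎counterexample e)

  -- By pigeonhole every unit has some power a ^ d ≈ 1 with 0 < d ≤ p.
  p!-exponent : Exponent (p !)
  p!-exponent {a} a≉0
    with i , j , i<j , same ← pigeonhole (ℕ.n<1+n p) (λ (j : Fin (suc p)) → reduce (a ^ toℕ j)) =
    ^≈1-∣ {a} {toℕ j ∸ toℕ i} (^-cancel a≉0 (ℕ.<⇒≤ i<j) (reduce-injective same))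
          (m≤n⇒m∣n! (ℕ.m<n⇒0<n∸m i<j) j∸i≤p)
    where
    j∸i≤p : toℕ j ∸ toℕ i ≤ p
    j∸i≤p = ℕ.≤-trans (ℕ.m∸n≤m (toℕ j) (toℕ i)) (ℕ.≤-pred (toℕ<n j))

  module _ {E : ℕ} ⦃ E≢0 : NonZero E ⦄ (E-exponent : Exponent E)
           (E-minimal : ∀ {d} → 0 < d → d < E → ∃[ b ] b ≉ 0ℤ × b ^ d ≉ 1ℤ) where

    p∸1≤E : p ∸ 1 ≤ E
    p∸1≤E = x^E≈1-roots≤E r r-inj (λ i → E-exponent (r≉0 i))
      where
      r : Fin (p ∸ 1) → ℤ
      r i = + suc (toℕ i)
      r<p : ∀ i → suc (toℕ i) < p
      r<p i = ℕ.<-≤-trans (s≤s (toℕ<n i)) (ℕ.≤-reflexive (ℕ.suc-pred p))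
      r-inj : ∀ {i j} → r i ≈ r j → i ≡ j
      r-inj {i} {j} rᵢ≈rⱼ = toℕ-injective (ℕ.suc-injective (≈-canonical (r<p i) (r<p j) rᵢ≈rⱼ))
      r≉0 : ∀ i → r i ≉ 0ℤ
      r≉0 i rᵢ≈0 = contradiction (≈-canonical (r<p i) (ℕ.>-nonZero⁻¹ p) rᵢ≈0) λ ()

    elementOfPrimePowerOrder : ∀ {q} e → Prime q → q ℕ.^ suc e ∣ E → ∃[ y ] HasOrder y (q ℕ.^ suc e)
    elementOfPrimePowerOrder {q} e q-prime (divides R E≡R*Q) = fromCounterexample (E-minimal 0<d d<E)
      where
      d = R ℕ.* q ℕ.^ e
      E≡d*q : E ≡ d ℕ.* q
      E≡d*q = trans E≡R*Q (reassoc R q (q ℕ.^ e))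
        where
        reassoc : ∀ a b c → a ℕ.* (b ℕ.* c) ≡ a ℕ.* c ℕ.* b
        reassoc = ℕ.solve-∀
      instance
        _ = prime⇒nonTrivial q-prime
        d≢0 : NonZero d
        d≢0 = ℕ.m*n≢0⇒m≢0 d ⦃ subst NonZero E≡d*q E≢0 ⦄
      0<d : 0 < d
      0<d = ℕ.>-nonZero⁻¹ d
      d<E : d < E
      d<E = subst (d <_) (sym E≡d*q) (ℕ.m<m*n d q (ℕ.nonTrivial⇒n>1 q))
      fromCounterexample : ∃[ b ] b ≉ 0ℤ × b ^ d ≉ 1ℤ → ∃[ y ] HasOrder y (q ℕ.^ suc e)
      fromCounterexample (b , b≉0 , b^d≉1) = b ^ R , hasOrder-primePower e q-prime y^Q≈1 y^q^e≉1
        where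
        y^Q≈1 : (b ^ R) ^ (q ℕ.^ suc e) ≈ 1ℤ
        y^Q≈1 = subst (_≈ 1ℤ) (trans (cong (b ^_) E≡R*Q) (sym (ℤ.^-*-assoc b R _))) (E-exponent b≉0)
        y^q^e≉1 : (b ^ R) ^ (q ℕ.^ e) ≉ 1ℤ
        y^q^e≉1 = b^d≉1 ∘ subst (_≈ 1ℤ) (ℤ.^-*-assoc b R (q ℕ.^ e))

    elementOfOrder : ∀ N → N ∣ E → ∃[ a ] HasOrder a N
    elementOfOrder N = go N (<-wellFounded N)
      where
      go : ∀ N → Acc _<_ N → N ∣ E → ∃[ a ] HasOrder a N
      go 0        _         0∣E = contradiction (0∣⇒≡0 0∣E) (ℕ.≢-nonZero⁻¹ E)
      go 1        _         _   = 1ℤ , ≈-refl , λ k _ → 1∣ k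
      go N@(2+ _) (acc rec) N∣E
        with q , q-prime , q∣N ← ∃primeDivisor (s≤s (s≤s z≤n))
        with primePowerDecomposition q-prime N
      ... | zero  , M , N≡M   , q∤M = contradiction (subst (q ∣_) (trans N≡M (ℕ.*-identityˡ M)) q∣N) q∤M
      ... | suc e , M , N≡Q*M , q∤M =
        combine (go M (rec M<N) (∣-trans (divides Q N≡Q*M) N∣E))
                (elementOfPrimePowerOrder e q-prime (∣-trans (divides M N≡M*Q) N∣E))
        where
        Q = q ℕ.^ suc e
        N≡M*Q : N ≡ M ℕ.* Q
        N≡M*Q = trans N≡Q*M (ℕ.*-comm Q M)
        instance
          _ = prime⇒nonZero q-prime
          _ = prime⇒nonTrivial q-prime
          M≢0 : NonZero M
          M≢0 = ℕ.m*n≢0⇒m≢0 M ⦃ subst NonZero N≡M*Q _ ⦄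
        1<Q : 1 < Q
        1<Q = ℕ.<-≤-trans (ℕ.nonTrivial⇒n>1 q) (ℕ.m≤m*n q (q ℕ.^ e) ⦃ ℕ.m^n≢0 q e ⦄)
        M<N : M < N
        M<N = subst (M <_) (sym N≡M*Q) (ℕ.m<m*n M Q 1<Q)
        combine : ∃[ a ] HasOrder a M → ∃[ y ] HasOrder y Q → ∃[ a ] HasOrder a N
        combine (a , a-order) (y , y-order) =
          a * y , subst (HasOrder (a * y)) (sym N≡M*Q)
                        (hasOrder-* a-order y-order (coprime-^ʳ (suc e) (∤⇒coprime q-prime q∤M)))

  leastExponent : ∃[ E ] (0 < E × Exponent E) × (∀ {d} → d < E → ¬ (0 < d × Exponent d))
  leastExponent = minimalWitness (λ e → (0 ℕ.<? e) ×-dec exponent? e)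
                                 (ℕ.>-nonZero⁻¹ (p !) ⦃ p ℕ.!≢0 ⦄ , p!-exponent)

  IsPrimitiveRoot : ℤ → Set
  IsPrimitiveRoot g = g ≉ 0ℤ × (∀ {i j} → i < p ∸ 1 → j < p ∸ 1 → g ^ i ≈ g ^ j → i ≡ j)

  primitiveRoot : ∃ IsPrimitiveRoot
  primitiveRoot = fromLeastExponent leastExponent
    where
    fromLeastExponent : ∃[ E ] (0 < E × Exponent E) × (∀ {d} → d < E → ¬ (0 < d × Exponent d)) →
                        ∃ IsPrimitiveRoot
    fromLeastExponent (E , (0<E , E-exponent) , E-least) =
      fromGenerator (elementOfOrder E-exponent E-minimal E ∣-refl)
      where
      instance _ = ℕ.>-nonZero 0<E
      E-minimal : ∀ {d} → 0 < d → d < E → ∃[ b ] b ≉ 0ℤ × b ^ d ≉ 1ℤ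
      E-minimal {d} 0<d d<E =
        [ (λ d-exponent → contradiction (0<d , d-exponent) (E-least d<E)) , id ]′
        (exponent⊎counterexample d)
      below-E : ∀ {i} → i < p ∸ 1 → i < E
      below-E i<p-1 = ℕ.<-≤-trans i<p-1 (p∸1≤E E-exponent E-minimal)
      fromGenerator : ∃[ g ] HasOrder g E → ∃ IsPrimitiveRoot
      fromGenerator (g , g-order@(g^E≈1 , _)) =
        g , ^≈1⇒≉0 (ℕ.pred E) (subst (λ k → g ^ k ≈ 1ℤ) (sym (ℕ.suc-pred E)) g^E≈1) ,
        λ i<p-1 j<p-1 → hasOrder-injective g-order (below-E i<p-1) (below-E j<p-1)

module MultiplicationByPrimitiveRoot {m : ℕ} (p-prime : Prime (suc (2+ m))) (g : ℤ)
                                    (g-primitive : PrimeModulus.IsPrimitiveRoot p-prime g) where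

  open PrimeModulus p-prime

  p : ℕ
  p = suc (2+ m)

  g≉0 : g ≉ 0ℤ
  g≉0 = proj₁ g-primitive

  g^-injective : ∀ {i j} → i < p ∸ 1 → j < p ∸ 1 → g ^ i ≈ g ^ j → i ≡ j
  g^-injective = proj₂ g-primitive

  g-1≉0 : g - 1ℤ ≉ 0ℤ
  g-1≉0 g-1≈0 = contradiction (g^-injective (s≤s z≤n) (s≤s (s≤s z≤n)) 1≈g*1) λ ()
    where
    1≈g*1 : 1ℤ ≈ g * 1ℤ
    1≈g*1 = ≈-trans (≈-sym (-≈0⇒≈ g-1≈0)) (≡⇒≈ (sym (ℤ.*-identityʳ g)))

  discreteLog : ∀ {a b} → a ≉ 0ℤ → b ≉ 0ℤ → ∃[ j ] j < p ∸ 1 × g ^ j * a ≈ b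
  discreteLog {a} {b} a≉0 b≉0 = fromPreimage (injective⇒surjective h-injective (reduce b))
    where
    h : Fin p → Fin p
    h zero    = zero
    h (suc j) = reduce (g ^ toℕ j * a)
    g^j*a≉0 : ∀ j → g ^ j * a ≉ 0ℤ
    g^j*a≉0 j = *-≉0 (^-≉0 j g≉0) a≉0
    h-injective : Injective _≡_ _≡_ h
    h-injective {zero}  {zero}  _        = refl
    h-injective {zero}  {suc j} 0≡hj     = contradiction (reduce-injective (sym 0≡hj)) (g^j*a≉0 (toℕ j))
    h-injective {suc i} {zero}  hi≡0     = contradiction (reduce-injective hi≡0) (g^j*a≉0 (toℕ i))
    h-injective {suc i} {suc j} hi≡hj    =
      cong suc (toℕ-injective (g^-injective (toℕ<n i) (toℕ<n j) (*-cancelʳ a≉0 (reduce-injective hi≡hj))))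
    fromPreimage : ∃[ i ] h i ≡ reduce b → ∃[ j ] j < p ∸ 1 × g ^ j * a ≈ b
    fromPreimage (zero  , 0≡b)  = contradiction (reduce-injective (sym 0≡b)) b≉0
    fromPreimage (suc j , hj≡b) = toℕ j , toℕ<n j , reduce-injective hj≡b

  scale : ℤ → Fin p → Fin p
  scale c x = reduce (c * [ x ])

  scale-injective : ∀ {c} → c ≉ 0ℤ → Injective _≡_ _≡_ (scale c)
  scale-injective c≉0 eq = [_]-injective (*-cancelˡ c≉0 (reduce-injective eq))

  π : Permutation′ p
  π = injective⇒permutation (scale g) (scale-injective g≉0)

  module _ (k : Fin p) where

    f : Fin p → Fin p
    f = π ·c^ toℕ k

    [f] : ∀ x → [ f x ] ≈ g * ([ x ] + [ k ])
    [f] x = begin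
      [ reduce (g * [ cpow (toℕ k) x ]) ]   ≈⟨ [reduce] _ ⟩
      g * [ cpow (toℕ k) x ]                ≈⟨ *-cong (≈-refl {g}) ([cpow] (toℕ k) x) ⟩
      g * ([ x ] + [ k ])                   ∎
      where open ≈-Reasoning

    fixedPoint : ∃[ x₀ ] [ x₀ ] ≈ g * ([ x₀ ] + [ k ])
    fixedPoint = fromPreimage (injective⇒surjective (scale-injective g-1≉0) (reduce (- (g * [ k ]))))
      where
      fromPreimage : ∃[ x ] scale (g - 1ℤ) x ≡ reduce (- (g * [ k ])) → ∃[ x₀ ] [ x₀ ] ≈ g * ([ x₀ ] + [ k ])
      fromPreimage (x₀ , eq) = x₀ , ≈-sym (begin
        g * ([ x₀ ] + [ k ])                               ≡⟨ expand g [ x₀ ] [ k ] ⟩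
        [ x₀ ] + ((g - 1ℤ) * [ x₀ ] + g * [ k ])           ≈⟨ +-cong (≈-refl {[ x₀ ]}) (+-cong x₀-scaled ≈-refl) ⟩
        [ x₀ ] + (- (g * [ k ]) + g * [ k ])               ≡⟨ cancel [ x₀ ] (g * [ k ]) ⟩
        [ x₀ ]                                             ∎)
        where
        open ≈-Reasoning
        x₀-scaled : (g - 1ℤ) * [ x₀ ] ≈ - (g * [ k ])
        x₀-scaled = reduce-injective eq
        expand : ∀ g x k → g * (x + k) ≡ x + ((g - 1ℤ) * x + g * k)
        expand = solve-∀
        cancel : ∀ x c → x + (- c + c) ≡ x
        cancel = solve-∀

    module _ (x₀ : Fin p) (x₀-fixed : [ x₀ ] ≈ g * ([ x₀ ] + [ k ])) where

      orbit : ∀ j x → [ iter f j x ] - [ x₀ ] ≈ g ^ j * ([ x ] - [ x₀ ])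
      orbit zero    x = ≡⇒≈ (sym (ℤ.*-identityˡ ([ x ] - [ x₀ ])))
      orbit (suc j) x = begin
        [ f y ] - [ x₀ ]                        ≈⟨ +-cong ([f] y) (-‿cong x₀-fixed) ⟩
        g * ([ y ] + [ k ]) - g * ([ x₀ ] + [ k ]) ≡⟨ factor g [ y ] [ x₀ ] [ k ] ⟩
        g * ([ y ] - [ x₀ ])                    ≈⟨ *-cong (≈-refl {g}) (orbit j x) ⟩
        g * (g ^ j * ([ x ] - [ x₀ ]))          ≡⟨ ℤ.*-assoc g (g ^ j) _ ⟨
        g ^ suc j * ([ x ] - [ x₀ ])            ∎
        where
        open ≈-Reasoning
        y = iter f j x
        factor : ∀ g y x₀ k → g * (y + k) - g * (x₀ + k) ≡ g * (y - x₀)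
        factor = solve-∀

      connected : ∀ {x y} → x ≢ x₀ → y ≢ x₀ → ∃[ j ] iter f (toℕ j) x ≡ y
      connected {x} {y} x≢x₀ y≢x₀ = fromDiscreteLog (discreteLog (offset≉0 x≢x₀) (offset≉0 y≢x₀))
        where
        offset≉0 : ∀ {z} → z ≢ x₀ → [ z ] - [ x₀ ] ≉ 0ℤ
        offset≉0 z≢x₀ = z≢x₀ ∘ [_]-injective ∘ -≈0⇒≈
        fromDiscreteLog : ∃[ j ] j < p ∸ 1 × g ^ j * ([ x ] - [ x₀ ]) ≈ [ y ] - [ x₀ ] →
                          ∃[ j ] iter f (toℕ j) x ≡ y
        fromDiscreteLog (j , j<p-1 , log) = fromℕ< j<p , [_]-injective (+-cancelʳ (- [ x₀ ]) (begin
          [ iter f (toℕ (fromℕ< j<p)) x ] - [ x₀ ]   ≡⟨ cong (λ i → [ iter f i x ] - [ x₀ ]) (toℕ-fromℕ< j<p) ⟩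
          [ iter f j x ] - [ x₀ ]                    ≈⟨ orbit j x ⟩
          g ^ j * ([ x ] - [ x₀ ])                   ≈⟨ log ⟩
          [ y ] - [ x₀ ]                             ∎))
          where
          open ≈-Reasoning
          j<p : j < p
          j<p = ℕ.m<n⇒m<1+n j<p-1

    cycF-π·c^k≤2 : cycF f ≤ 2
    cycF-π·c^k≤2 = let x₀ , x₀-fixed = fixedPoint in cycF≤2 f x₀ (connected x₀ x₀-fixed)

  p∸2≤dist : ∀ k → p ∸ 2 ≤ dist π k
  p∸2≤dist k = ℕ.∸-monoʳ-≤ p (cycF-π·c^k≤2 k)

-- The bounds t(p) ≥ p − 2 and t(n) ≤ n − 2

∃perm-dist≥n∸2 : ∀ {m} → Prime (suc (2+ m)) → ∃[ π ] ∀ k → suc (2+ m) ∸ 2 ≤ dist π k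
∃perm-dist≥n∸2 {m} p-prime = fromPrimitiveRoot (PrimeModulus.primitiveRoot p-prime)
  where
  fromPrimitiveRoot : ∃ (PrimeModulus.IsPrimitiveRoot p-prime) → ∃[ π ] ∀ k → suc (2+ m) ∸ 2 ≤ dist π k
  fromPrimitiveRoot (g , g-primitive) = π , p∸2≤dist
    where open MultiplicationByPrimitiveRoot p-prime g g-primitive

∃shift-dist≤n∸2 : ∀ {m} (π : Permutation′ (2+ m)) → ∃[ k ] dist π k ≤ 2+ m ∸ 2
∃shift-dist≤n∸2 {m} π =
  k , ℕ.∸-monoʳ-≤ (2+ m) (cycF≥2 (π ·c^ toℕ k) (cpow-injective (toℕ k) ∘ π-injective) f0≡0)
  where
  open Congruence (2+ m)
  k = π ⟨$⟩ˡ zero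
  π-injective : Injective _≡_ _≡_ (π ⟨$⟩ʳ_)
  π-injective eq = trans (sym (inverseˡ π)) (trans (cong (π ⟨$⟩ˡ_) eq) (inverseˡ π))
  f0≡0 : (π ·c^ toℕ k) zero ≡ zero
  f0≡0 = trans (cong (π ⟨$⟩ʳ_) ([_]-injective ([cpow] (toℕ k) zero))) (inverseʳ π)

corollary3p3 : ∀ (n : ℕ) → Prime n → TEquals n (n ∸ 2)
corollary3p3 0            0-prime = contradiction 0-prime ¬prime[0]
corollary3p3 1            1-prime = contradiction 1-prime ¬prime[1]
corollary3p3 2            _       = (Permutation.id , λ _ → z≤n) , ∃shift-dist≤n∸2
corollary3p3 (suc (2+ _)) n-prime = ∃perm-dist≥n∸2 n-prime , ∃shift-dist≤n∸2
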